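{- Let $n$ be a positive integer with $n\equiv 3 \pmod 4$. Then $va_3^{\equiv}(K_{n,n,n})\leq 3\left\lfloor \frac{n+1}{4}\right\rfloor$.
   Context: All graphs are finite and simple. A $t$-coloring of a graph $G$ is a map $f:V(G)\to\{1,\dots,t\}$, with color classes $V_i=\{v: f(v)=i\}$. It is equitable if $\big||V_i|-|V_j|\big|\le 1$ for all $i,j$. A $(t,k)$-tree-coloring of $G$ is a $t$-coloring such that every connected component of each induced subgraph $G[V_i]$ is a tree of maximum degree at most $k$; an equitable $(t,k)$-tree-coloring is a $(t,k)$-tree-coloring that is equitable. The strong equitable vertex $k$-arboricity $va_k^{\equiv}(G)$ is the smallest integer $t$ such that $G$ has an equitable $(t',k)$-tree-coloring for every integer $t'\ge t$. $K_{n,n,n}$ denotes the complete tripartite graph whose three partite sets each have exactly $n$ vertices. -}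

module Defs where

open import Data.Nat using (ℕ; zero; suc; _+_; _*_; _≤_)
open import Data.Fin using (Fin; zero; suc; inject₁; fromℕ; quotient)
open import Data.Fin.Properties using (_≟_)
open import Data.List using (List; length; filter)
open import Data.List.Base using (allFin)
open import Data.Product using (Σ; _×_; ∃-syntax)
open import Function.Definitions using (Injective)
open import Relation.Binary.PropositionalEquality using (_≡_; _≢_)
open import Relation.Nullary using (¬_; Dec)
open import Relation.Nullary.Decidable using (_×-dec_; ¬?)
open import Relation.Unary using (Pred)

record Graph : Set₁ where
  field
    N     : ℕ
    Adj   : Fin N → Fin N → Set
    adj?  : ∀ u v → Dec (Adj u v)
    sym   : ∀ {u v} → Adj u v → Adj v u
    irrefl : ∀ {u v} → Adj u v → u ≢ v

open Graph public

Coloring : Graph → ℕ → Set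
Coloring G t = Fin (N G) → Fin t

classSize : (G : Graph) {t : ℕ} → Coloring G t → Fin t → ℕ
classSize G f i = length (filter (λ v → f v ≟ i) (allFin (N G)))

Equitable : (G : Graph) {t : ℕ} → Coloring G t → Set
Equitable G f = ∀ i j → classSize G f i ≤ classSize G f j + 1

classDegree : (G : Graph) {t : ℕ} → Coloring G t → Fin (N G) → ℕ
classDegree G f v =
  length (filter (λ w → (f w ≟ f v) ×-dec adj? G v w) (allFin (N G)))

-- A cycle of length r+3 in the induced subgraph G[V_i]:
-- distinct vertices c 0, …, c (r+2), all colored i, with consecutive ones
-- adjacent and c (r+2) adjacent to c 0.
record MonoCycle (G : Graph) {t : ℕ} (f : Coloring G t) (i : Fin t) : Set where
  field
    r        : ℕ
    c        : Fin (suc (suc (suc r))) → Fin (N G)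
    distinct : Injective _≡_ _≡_ c
    colored  : ∀ j → f (c j) ≡ i
    step     : ∀ (j : Fin (suc (suc r))) → Adj G (c (inject₁ j)) (c (suc j))
    close    : Adj G (c (fromℕ (suc (suc r)))) (c zero)

-- (t,k)-tree-coloring: every component of each G[V_i] is a tree (i.e. G[V_i]
-- is acyclic) of maximum degree at most k.
TreeColoring : (G : Graph) (t k : ℕ) → Coloring G t → Set
TreeColoring G t k f =
  (∀ i → ¬ MonoCycle G f i) × (∀ v → classDegree G f v ≤ k)

HasEqTreeColoring : Graph → ℕ → ℕ → Set
HasEqTreeColoring G t k =
  Σ (Coloring G t) λ f → TreeColoring G t k f × Equitable G f

-- va_k^≡(G) ≤ T : the least t such that G has an equitable (t',k)-tree-coloring
-- for every t' ≥ t is at most T, i.e. some t ≤ T has this property.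
StrongEqVA≤ : Graph → ℕ → ℕ → Set
StrongEqVA≤ G k T =
  ∃[ t ] (t ≤ T × (∀ t' → t ≤ t' → HasEqTreeColoring G t' k))

-- K_{n,n,n} on Fin (3 * n); vertex v lies in part (quotient n v) ∈ Fin 3.
part : (n : ℕ) → Fin (3 * n) → Fin 3
part n v = quotient n v

K3 : ℕ → Graph
K3 n = record
  { N = 3 * n
  ; Adj = λ u v → part n u ≢ part n v
  ; adj? = λ u v → ¬? (part n u ≟ part n v)
  ; sym = λ p q → p (Relation.Binary.PropositionalEquality.sym q)
  ; irrefl = λ p q → p (Relation.Binary.PropositionalEquality.cong (part n) q)
  }

-- Order the 3n vertices part by part and cut the sequence into t consecutive blocks of
-- ⌊3n/t⌋ or ⌊3n/t⌋ + 1 vertices, the colour classes. When 4t > 3n a block has at most four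
-- vertices, hence meets at most two parts and induces some K_{a,b} with a + b ≤ 4, which is a
-- forest of maximum degree at most 3 unless a = b = 2. Letting the blocks of size four start at
-- positions ≡ 3 (mod 4) puts their middle at a position ≡ 1 (mod 4), which is neither n nor the
-- even number 2n when n ≢ 1 (mod 4). Finally n ≡ 3 (mod 4) and t ≥ 3⌊(n+1)/4⌋ give 4t > 3n.
module Submission where

open import Defs hiding (sym)
open import Data.Nat using (ℕ; zero; suc; _+_; _*_; _∸_; _⊓_; _/_; _%_; _≤_; _<_; _≤?_; _<?_; z≤n; s≤s; NonZero; >-nonZero)
open import Data.Nat.Properties
open import Data.Fin using (Fin; zero; suc; toℕ; fromℕ; inject₁; combine; remainder) renaming (_≟_ to _≟ᶠ_)
open import Data.Fin.Properties using (toℕ-injective; toℕ<n; toℕ-fromℕ; toℕ-inject₁; toℕ-combine; combine-remQuot)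
open import Data.Nat.Tactic.RingSolver using (solve-∀)
open import Data.Nat.DivMod using (m≡m%n+[m/n]*n; m%n<n; m/n*n≤m; [m+kn]%n≡m%n; m*n%n≡0; m*n/n≡m; m%n≤m)
open import Data.List using (List; []; _∷_; [_]; length; filter; map; tabulate; allFin; applyUpTo; upTo; _++_)
open import Data.List.Properties using (filter-++; length-++; filter-accept; filter-reject; filter-≐; filter-notAll; map-tabulate; upTo-∷ʳ)
open import Data.List.Membership.Propositional using (lose)
open import Data.List.Membership.Propositional.Properties using (∈-filter⁺; ∈-allFin)
open import Data.Product using (Σ; _×_; _,_; proj₁; proj₂; ∃₂)
open import Data.Sum using (_⊎_; inj₁; inj₂)
open import Data.Bool using (true; false)
open import Data.Empty using (⊥-elim)
open import Function using (_∘_; id)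
open import Function.Bundles using (_⇔_; mk⇔; Equivalence)
open import Level using (0ℓ)
open import Relation.Binary.PropositionalEquality using (_≡_; _≢_; refl; sym; trans; cong; subst; module ≡-Reasoning)
open import Relation.Binary.Definitions using (tri<; tri≈; tri>)
open import Relation.Nullary using (¬_; Dec; yes; no; does)
open import Relation.Nullary.Decidable using (_×-dec_)
open import Relation.Unary using (Pred; Decidable)

private
  variable
    X Y : Set

length-filter-∘ : {P : Pred Y 0ℓ} (P? : Decidable P) (f : X → Y) (xs : List X) →
  length (filter (P? ∘ f) xs) ≡ length (filter P? (map f xs))
length-filter-∘ P? f [] = refl
length-filter-∘ P? f (x ∷ xs) with does (P? (f x))
... | true = cong suc (length-filter-∘ P? f xs)
... | false = length-filter-∘ P? f xs

filter-×-dec : {P Q : Pred X 0ℓ} (P? : Decidable P) (Q? : Decidable Q) (xs : List X) →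
  filter (λ x → P? x ×-dec Q? x) xs ≡ filter Q? (filter P? xs)
filter-×-dec P? Q? [] = refl
filter-×-dec P? Q? (x ∷ xs) with does (P? x)
... | false = filter-×-dec P? Q? xs
... | true with does (Q? x)
...   | true = cong (x ∷_) (filter-×-dec P? Q? xs)
...   | false = filter-×-dec P? Q? xs

tabulate-∘toℕ : ∀ n (f : ℕ → X) → tabulate {n = n} (f ∘ toℕ) ≡ applyUpTo f n
tabulate-∘toℕ zero f = refl
tabulate-∘toℕ (suc n) f = cong (f 0 ∷_) (tabulate-∘toℕ n (f ∘ suc))

map-toℕ-allFin : ∀ n → map toℕ (allFin n) ≡ upTo n
map-toℕ-allFin n = trans (map-tabulate id toℕ) (tabulate-∘toℕ n id)

between? : ∀ a b m → Dec (a ≤ m × m < b)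
between? a b m = a ≤? m ×-dec m <? b

length-filter-between-upTo : ∀ a b N → length (filter (between? a b) (upTo N)) ≡ N ⊓ b ∸ a
length-filter-between-upTo a b zero = sym (0∸n≡0 a)
length-filter-between-upTo a b (suc N) = begin
  length (filter P? (upTo (suc N)))                          ≡⟨ cong (length ∘ filter P?) (sym (upTo-∷ʳ N)) ⟩
  length (filter P? (upTo N ++ [ N ]))                       ≡⟨ cong length (filter-++ P? (upTo N) [ N ]) ⟩
  length (filter P? (upTo N) ++ filter P? [ N ])             ≡⟨ length-++ (filter P? (upTo N)) ⟩
  length (filter P? (upTo N)) + length (filter P? [ N ])     ≡⟨ cong (_+ length (filter P? [ N ])) (length-filter-between-upTo a b N) ⟩
  N ⊓ b ∸ a + length (filter P? [ N ])                       ≡⟨ last-step ⟩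
  suc N ⊓ b ∸ a                                              ∎
  where
  open ≡-Reasoning
  P? = between? a b
  last-step : N ⊓ b ∸ a + length (filter P? [ N ]) ≡ suc N ⊓ b ∸ a
  last-step with a ≤? N | N <? b
  ... | yes a≤N | yes N<b
    rewrite filter-accept P? {xs = []} (a≤N , N<b) | m≤n⇒m⊓n≡m (<⇒≤ N<b) | m≤n⇒m⊓n≡m N<b
    = trans (sym (+-∸-comm 1 a≤N)) (cong (_∸ a) (+-comm N 1))
  ... | yes _ | no N≮b
    rewrite filter-reject P? {xs = []} (N≮b ∘ proj₂) | m≥n⇒m⊓n≡n (≮⇒≥ N≮b) | m≥n⇒m⊓n≡n (m≤n⇒m≤1+n (≮⇒≥ N≮b))
    = +-identityʳ (b ∸ a)
  ... | no a≰N | _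
    rewrite filter-reject P? {xs = []} (a≰N ∘ proj₁)
          | m≤n⇒m∸n≡0 (≤-trans (m⊓n≤m N b) (<⇒≤ (≰⇒> a≰N)))
          | m≤n⇒m∸n≡0 (≤-trans (m⊓n≤m (suc N) b) (≰⇒> a≰N))
    = refl

module _ (G : Graph) {t : ℕ} (f : Coloring G t) where

  equitable-if-classSizes : ∀ s → (∀ i → s ≤ classSize G f i × classSize G f i ≤ suc s) → Equitable G f
  equitable-if-classSizes s bounds i j =
    ≤-trans (proj₂ (bounds i)) (subst (_≤ classSize G f j + 1) (+-comm s 1) (+-monoˡ-≤ 1 (proj₁ (bounds j))))

  classDegree<classSize : ∀ v → classDegree G f v < classSize G f (f v)
  classDegree<classSize v = begin-strict
    classDegree G f v                                    ≡⟨ cong length (filter-×-dec sameColour? (adj? G v) vertices) ⟩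
    length (filter (adj? G v) (filter sameColour? vertices)) <⟨ filter-notAll (adj? G v) _ v-nonadjacent ⟩
    classSize G f (f v)                                  ∎
    where
    open ≤-Reasoning
    vertices = allFin (N G)
    sameColour? = λ w → f w ≟ᶠ f v
    v-nonadjacent = lose (∈-filter⁺ sameColour? (∈-allFin v) refl) (λ v~v → irrefl G v~v refl)

  -- A cycle has three consecutive edges c₋₁c₀, c₀c₁, c₁c₂, and no single vertex covers all three.
  noMonoCycle-if-star : ∀ i (Centre : Pred (Fin (N G)) 0ℓ) → (∀ {u v} → Centre u → Centre v → u ≡ v) →
    (∀ u v → f u ≡ i → f v ≡ i → Adj G u v → Centre u ⊎ Centre v) → ¬ MonoCycle G f i
  noMonoCycle-if-star i Centre unique star
                      record { r = r ; c = c ; distinct = distinct ; colored = colored ; step = step ; close = close }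
    with star (c zero) (c (suc zero)) (colored _) (colored _) (step zero)
       | star (c (suc zero)) (c (suc (suc zero))) (colored _) (colored _) (step (suc zero))
       | star (c (fromℕ (suc (suc r)))) (c zero) (colored _) (colored _) close
  ... | inj₁ c₀ | inj₁ c₁ | _ with () ← distinct (unique c₁ c₀)
  ... | inj₁ c₀ | inj₂ c₂ | _ with () ← distinct (unique c₂ c₀)
  ... | inj₂ c₁ | _ | inj₁ cₗ with () ← distinct (unique cₗ c₁)
  ... | inj₂ c₁ | _ | inj₂ c₀ with () ← distinct (unique c₀ c₁)

Block : (ℕ → ℕ) → ℕ → ℕ → Set
Block B i m = B i ≤ m × m < B (suc i)

block-unique : ∀ B → (∀ {i j} → i ≤ j → B i ≤ B j) → ∀ {i j m} → Block B i m → Block B j m → i ≡ j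
block-unique B B-mono {i} {j} (Bi≤m , m<Bi+1) (Bj≤m , m<Bj+1) with <-cmp i j
... | tri< i<j _ _ = ⊥-elim (<-irrefl refl (<-≤-trans m<Bi+1 (≤-trans (B-mono i<j) Bj≤m)))
... | tri≈ _ i≡j _ = i≡j
... | tri> _ _ j<i = ⊥-elim (<-irrefl refl (<-≤-trans m<Bj+1 (≤-trans (B-mono j<i) Bi≤m)))

module BlockColouring (G : Graph) (t : ℕ) (B : ℕ → ℕ) (B-mono : ∀ {i j} → i ≤ j → B i ≤ B j)
                      (B-zero : B 0 ≡ 0) (B-last : B t ≡ N G) where

  locate : ∀ u m → m < B u → Σ (Fin u) λ i → Block B (toℕ i) m
  locate zero m m<B₀ = ⊥-elim (n≮0 (subst (m <_) B-zero m<B₀))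
  locate (suc u) m m<Bu+1 with m <? B u
  ... | yes m<Bu = let i , block = locate u m m<Bu in
                   inject₁ i , subst (λ k → Block B k m) (sym (toℕ-inject₁ i)) block
  ... | no m≮Bu = fromℕ u , subst (λ k → Block B k m) (sym (toℕ-fromℕ u)) (≮⇒≥ m≮Bu , m<Bu+1)

  located : ∀ v → Σ (Fin t) λ i → Block B (toℕ i) (toℕ v)
  located v = locate t (toℕ v) (subst (toℕ v <_) (sym B-last) (toℕ<n v))

  colour : Coloring G t
  colour v = proj₁ (located v)

  colour≡⇔block : ∀ v i → colour v ≡ i ⇔ Block B (toℕ i) (toℕ v)
  colour≡⇔block v i = mk⇔ (λ { refl → proj₂ (located v) }) (toℕ-injective ∘ block-unique B B-mono (proj₂ (located v)))

  classSize-colour : ∀ i → classSize G colour i ≡ B (suc (toℕ i)) ∸ B (toℕ i)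
  classSize-colour i = begin
    classSize G colour i                                      ≡⟨ cong length (filter-≐ (λ v → colour v ≟ᶠ i) (between? a b ∘ toℕ) block⇔ (allFin (N G))) ⟩
    length (filter (between? a b ∘ toℕ) (allFin (N G)))       ≡⟨ length-filter-∘ (between? a b) toℕ (allFin (N G)) ⟩
    length (filter (between? a b) (map toℕ (allFin (N G))))   ≡⟨ cong (length ∘ filter (between? a b)) (map-toℕ-allFin (N G)) ⟩
    length (filter (between? a b) (upTo (N G)))               ≡⟨ length-filter-between-upTo a b (N G) ⟩
    N G ⊓ b ∸ a                                               ≡⟨ cong (_∸ a) (m≥n⇒m⊓n≡n b≤N) ⟩
    b ∸ a                                                     ∎
    where
    open ≡-Reasoning
    a = B (toℕ i)
    b = B (suc (toℕ i))
    block⇔ = (λ {v} → Equivalence.to (colour≡⇔block v i)) , (λ {v} → Equivalence.from (colour≡⇔block v i))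
    b≤N : b ≤ N G
    b≤N = subst (b ≤_) B-last (B-mono (toℕ<n i))

InPart : ℕ → ℕ → ℕ → Set
InPart n = Block (_* n)

inPart-unique : ∀ n {k l a} → InPart n k a → InPart n l a → k ≡ l
inPart-unique n = block-unique (_* n) (*-monoˡ-≤ n)

inPart-div : ∀ n .{{_ : NonZero n}} a → InPart n (a / n) a
inPart-div n a = m/n*n≤m a n , subst (_< n + a / n * n) (sym (m≡m%n+[m/n]*n a n)) (+-monoˡ-< (a / n * n) (m%n<n a n))

inPart-part : ∀ n (v : Fin (3 * n)) → InPart n (toℕ (part n v)) (toℕ v)
inPart-part n v = subst (InPart n q) v≡qn+r (qn≤qn+r , qn+r<n+qn)
  where
  q = toℕ (part n v)
  r = toℕ (remainder {3} n v)
  v≡qn+r : q * n + r ≡ toℕ v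
  v≡qn+r = begin
    q * n + r                                       ≡⟨ cong (_+ r) (*-comm q n) ⟩
    n * q + r                                       ≡⟨ sym (toℕ-combine (part n v) (remainder {3} n v)) ⟩
    toℕ (combine (part n v) (remainder {3} n v))    ≡⟨ cong toℕ (combine-remQuot {3} n v) ⟩
    toℕ v                                           ∎
    where open ≡-Reasoning
  qn≤qn+r : q * n ≤ q * n + r
  qn≤qn+r = m≤m+n (q * n) r
  qn+r<n+qn : q * n + r < n + q * n
  qn+r<n+qn = subst (q * n + r <_) (+-comm (q * n) n) (+-monoʳ-< (q * n) (toℕ<n (remainder {3} n v)))

part-if-inPart : ∀ n (v : Fin (3 * n)) k → InPart n k (toℕ v) → toℕ (part n v) ≡ k
part-if-inPart n v k = inPart-unique n (inPart-part n v)

-- The multiple k n of n cuts [x, x + L) into two pieces of size at least two.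
BalancedCut : ℕ → ℕ → ℕ → ℕ → Set
BalancedCut n x L k = 2 + x ≤ k * n × 2 + k * n ≤ x + L

-- Starting from the part containing x, the next multiple of n either lies beyond the
-- interval, or cuts off only its first or only its last element.
almost-inOnePart : ∀ n .{{_ : NonZero n}} x L → L ≤ suc n → (∀ k → ¬ BalancedCut n x L k) →
  ∃₂ λ P w → ∀ a → x ≤ a → a < x + L → InPart n P a ⊎ a ≡ w
almost-inOnePart n x L L≤1+n no-cut with inPart-div n x
... | kn≤x , x<B with x + L ≤? suc (x / n) * n
...   | yes inside = x / n , x , λ a x≤a a<x+L → inj₁ (≤-trans kn≤x x≤a , <-≤-trans a<x+L inside)
...   | no _ with 2 + x ≤? suc (x / n) * n
...     | no 2+x≰B = suc (x / n) , x , first-cut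
  where
  B = suc (x / n) * n
  B≡1+x : B ≡ suc x
  B≡1+x = ≤-antisym (≤-pred (≰⇒> 2+x≰B)) x<B
  first-cut : ∀ a → x ≤ a → a < x + L → InPart n (suc (x / n)) a ⊎ a ≡ x
  first-cut a x≤a a<x+L with m≤n⇒m<n∨m≡n x≤a
  ... | inj₂ x≡a = inj₂ (sym x≡a)
  ... | inj₁ x<a = inj₁ (subst (_≤ a) (sym B≡1+x) x<a , <-≤-trans a<x+L x+L≤n+B)
    where
    x+L≤n+B : x + L ≤ n + B
    x+L≤n+B = begin
      x + L       ≤⟨ +-monoʳ-≤ x L≤1+n ⟩
      x + suc n   ≡⟨ +-suc x n ⟩
      suc x + n   ≡⟨ cong (_+ n) (sym B≡1+x) ⟩
      B + n       ≡⟨ +-comm B n ⟩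
      n + B       ∎
      where open ≤-Reasoning
...     | yes 2+x≤B = x / n , suc (x / n) * n , last-cut
  where
  B = suc (x / n) * n
  x+L≤1+B : x + L ≤ suc B
  x+L≤1+B = ≤-pred (≰⇒> (no-cut (suc (x / n)) ∘ (2+x≤B ,_)))
  last-cut : ∀ a → x ≤ a → a < x + L → InPart n (x / n) a ⊎ a ≡ B
  last-cut a x≤a a<x+L with a <? B
  ... | yes a<B = inj₁ (≤-trans kn≤x x≤a , a<B)
  ... | no a≮B = inj₂ (≤-antisym (≤-pred (<-≤-trans a<x+L x+L≤1+B)) (≮⇒≥ a≮B))

K3-noMonoCycle : ∀ n {t} (f : Coloring (K3 n) t) i P w →
  (∀ v → f v ≡ i → InPart n P (toℕ v) ⊎ toℕ v ≡ w) → ¬ MonoCycle (K3 n) f i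
K3-noMonoCycle n f i P w almost =
  noMonoCycle-if-star (K3 n) f i (λ v → toℕ v ≡ w) (λ u≡w v≡w → toℕ-injective (trans u≡w (sym v≡w))) star
  where
  star : ∀ u v → f u ≡ i → f v ≡ i → part n u ≢ part n v → toℕ u ≡ w ⊎ toℕ v ≡ w
  star u v fu≡i fv≡i u≁v with almost u fu≡i | almost v fv≡i
  ... | inj₂ u≡w | _ = inj₁ u≡w
  ... | inj₁ _ | inj₂ v≡w = inj₂ v≡w
  ... | inj₁ u∈P | inj₁ v∈P = ⊥-elim (u≁v (toℕ-injective (trans (part-if-inPart n u P u∈P) (sym (part-if-inPart n v P v∈P)))))

balancedCut-of-4 : ∀ {n x L k} → L ≤ 4 → BalancedCut n x L k → k * n ≡ 2 + x × L ≡ 4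
balancedCut-of-4 {n} {x} {L} {k} L≤4 (2+x≤kn , 2+kn≤x+L) = ≤-antisym kn≤2+x 2+x≤kn , ≤-antisym L≤4 4≤L
  where
  kn≤2+x : k * n ≤ 2 + x
  kn≤2+x = +-cancelˡ-≤ 2 _ _ (≤-trans 2+kn≤x+L (subst (x + L ≤_) (+-comm x 4) (+-monoʳ-≤ x L≤4)))
  4≤L : 4 ≤ L
  4≤L = +-cancelˡ-≤ x _ _ (subst (_≤ x + L) (+-comm 4 x) (≤-trans (+-monoʳ-≤ 2 2+x≤kn) 2+kn≤x+L))

-- Boundaries of a first block of size s, then e blocks of size s + 1, then blocks of size s.
boundary : ℕ → ℕ → ℕ → ℕ
boundary s e i = i * s + (i ∸ 1) ⊓ e

boundary-mono : ∀ s e {i j} → i ≤ j → boundary s e i ≤ boundary s e j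
boundary-mono s e i≤j = +-mono-≤ (*-monoˡ-≤ s i≤j) (⊓-monoˡ-≤ e (∸-monoˡ-≤ 1 i≤j))

boundary-step : ∀ s e i → boundary s e (suc i) ≡ s + boundary s e i
                        ⊎ boundary s e (suc i) ≡ suc s + boundary s e i × 1 + boundary s e i ≡ i * suc s
boundary-step s e zero = inj₁ (+-identityʳ (s + 0))
boundary-step s e (suc j) with suc j ≤? e
... | yes j<e rewrite m≤n⇒m⊓n≡m j<e | m≤n⇒m⊓n≡m (<⇒≤ j<e) = inj₂ (longer s j , aligned s j)
  where
  longer : ∀ s j → suc (suc j) * s + suc j ≡ suc s + (suc j * s + j)
  longer = solve-∀
  aligned : ∀ s j → 1 + (suc j * s + j) ≡ suc j * suc s
  aligned = solve-∀
... | no j≮e rewrite m≥n⇒m⊓n≡n (≮⇒≥ j≮e) | m≥n⇒m⊓n≡n (m≤n⇒m≤1+n (≮⇒≥ j≮e)) = inj₁ (same s j e)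
  where
  same : ∀ s j e → suc (suc j) * s + e ≡ s + (suc j * s + e)
  same = solve-∀

small-multiple-≢1+4i : ∀ n i k → n % 4 ≢ 1 → k < 3 → k * n ≢ 1 + i * 4
small-multiple-≢1+4i n i 0 _ _ ()
small-multiple-≢1+4i n i 1 n%4≢1 _ n≡1+4i = n%4≢1 (begin
  n % 4             ≡⟨ cong (_% 4) (trans (sym (+-identityʳ n)) n≡1+4i) ⟩
  (1 + i * 4) % 4   ≡⟨ [m+kn]%n≡m%n 1 i 4 ⟩
  1                 ∎)
  where open ≡-Reasoning
small-multiple-≢1+4i n i 2 _ _ 2n≡1+4i = 0≢1+n (begin
  0                       ≡⟨ sym (m*n%n≡0 n 2) ⟩
  (n * 2) % 2             ≡⟨ cong (_% 2) (*-comm n 2) ⟩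
  (2 * n) % 2             ≡⟨ cong (_% 2) 2n≡1+4i ⟩
  (1 + i * 4) % 2         ≡⟨ cong (λ m → (1 + m) % 2) (*-assoc i 2 2) ⟨
  (1 + i * 2 * 2) % 2     ≡⟨ [m+kn]%n≡m%n 1 (i * 2) 2 ⟩
  1                       ∎)
  where open ≡-Reasoning
small-multiple-≢1+4i n i (suc (suc (suc k))) _ (s≤s (s≤s (s≤s ())))

module K3-BlockColouring (n t : ℕ) .{{_ : NonZero t}} (3≤n : 3 ≤ n) (n%4≢1 : n % 4 ≢ 1) (3n<4t : 3 * n < 4 * t) where

  s e : ℕ
  s = 3 * n / t
  e = 3 * n % t

  boundary-last : boundary s e t ≡ 3 * n
  boundary-last = begin
    t * s + (t ∸ 1) ⊓ e   ≡⟨ cong (t * s +_) (m≥n⇒m⊓n≡n (<⇒≤pred (m%n<n (3 * n) t))) ⟩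
    t * s + e             ≡⟨ +-comm (t * s) e ⟩
    e + t * s             ≡⟨ cong (e +_) (*-comm t s) ⟩
    e + s * t             ≡⟨ m≡m%n+[m/n]*n (3 * n) t ⟨
    3 * n                 ∎
    where open ≡-Reasoning

  s≤3 : s ≤ 3
  s≤3 with s ≤? 3
  ... | yes s≤3 = s≤3
  ... | no s≰3 = ⊥-elim (<-irrefl refl (<-≤-trans 3n<4t (≤-trans (*-monoˡ-≤ t (≰⇒> s≰3)) (m/n*n≤m (3 * n) t))))

  open BlockColouring (K3 n) t (boundary s e) (boundary-mono s e) refl boundary-last public

  start end size : Fin t → ℕ
  start i = boundary s e (toℕ i)
  end i = boundary s e (suc (toℕ i))
  size i = end i ∸ start i

  start+size≡end : ∀ i → start i + size i ≡ end i
  start+size≡end i = m+[n∸m]≡n (boundary-mono s e (n≤1+n (toℕ i)))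

  end≤3n : ∀ i → end i ≤ 3 * n
  end≤3n i = subst (end i ≤_) boundary-last (boundary-mono s e (toℕ<n i))

  size-cases : ∀ i → size i ≡ s ⊎ size i ≡ suc s × 1 + start i ≡ toℕ i * suc s
  size-cases i with boundary-step s e (toℕ i)
  ... | inj₁ end≡ = inj₁ (trans (cong (_∸ start i) end≡) (m+n∸n≡m s (start i)))
  ... | inj₂ (end≡ , aligned) = inj₂ (trans (cong (_∸ start i) end≡) (m+n∸n≡m (suc s) (start i)) , aligned)

  size-bounds : ∀ i → s ≤ size i × size i ≤ suc s
  size-bounds i with size-cases i
  ... | inj₁ size≡s = ≤-reflexive (sym size≡s) , subst (_≤ suc s) (sym size≡s) (n≤1+n s)
  ... | inj₂ (size≡1+s , _) = subst (s ≤_) (sym size≡1+s) (n≤1+n s) , ≤-reflexive size≡1+s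

  size≤4 : ∀ i → size i ≤ 4
  size≤4 i = ≤-trans (proj₂ (size-bounds i)) (s≤s s≤3)

  start-of-4 : ∀ i → size i ≡ 4 → 1 + start i ≡ toℕ i * 4
  start-of-4 i size≡4 with size-cases i
  ... | inj₁ size≡s = ⊥-elim (<-irrefl refl (≤-trans (≤-reflexive (trans (sym size≡4) size≡s)) s≤3))
  ... | inj₂ (size≡1+s , aligned) = subst (λ m → 1 + start i ≡ toℕ i * m) (trans (sym size≡1+s) size≡4) aligned

  no-balancedCut : ∀ i k → ¬ BalancedCut n (start i) (size i) k
  no-balancedCut i k cut@(_ , 2+kn≤start+size) with balancedCut-of-4 {n = n} {k = k} (size≤4 i) cut
  ... | kn≡2+start , size≡4 =
    small-multiple-≢1+4i n (toℕ i) k n%4≢1 k<3 (trans kn≡2+start (cong suc (start-of-4 i size≡4)))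
    where
    open ≤-Reasoning hiding (start)
    k<3 : k < 3
    k<3 = *-cancelʳ-< n k 3 (begin-strict
      k * n                <⟨ s≤s (m≤n+m (k * n) 1) ⟩
      2 + k * n            ≤⟨ 2+kn≤start+size ⟩
      start i + size i     ≡⟨ start+size≡end i ⟩
      end i                ≤⟨ end≤3n i ⟩
      3 * n                ∎)

  class-almost-inOnePart : ∀ i → ∃₂ λ P w → ∀ v → colour v ≡ i → InPart n P (toℕ v) ⊎ toℕ v ≡ w
  class-almost-inOnePart i with almost-inOnePart n {{>-nonZero (≤-trans (s≤s z≤n) 3≤n)}} (start i) (size i)
                                                 (≤-trans (size≤4 i) (s≤s 3≤n)) (no-balancedCut i)
  ... | P , w , almost = P , w , λ v colour≡i →
    let start≤v , v<end = Equivalence.to (colour≡⇔block v i) colour≡i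
    in almost (toℕ v) start≤v (subst (toℕ v <_) (sym (start+size≡end i)) v<end)

  treeColouring : TreeColoring (K3 n) t 3 colour
  treeColouring = acyclic , degree≤3
    where
    acyclic : ∀ i → ¬ MonoCycle (K3 n) colour i
    acyclic i = let P , w , almost = class-almost-inOnePart i in K3-noMonoCycle n colour i P w almost
    degree≤3 : ∀ v → classDegree (K3 n) colour v ≤ 3
    degree≤3 v = ≤-pred (<-≤-trans (classDegree<classSize (K3 n) colour v)
                                   (subst (_≤ 4) (sym (classSize-colour (colour v))) (size≤4 (colour v))))

  equitable : Equitable (K3 n) colour
  equitable = equitable-if-classSizes (K3 n) colour s λ i →
    subst (λ m → s ≤ m × m ≤ suc s) (sym (classSize-colour i)) (size-bounds i)

K3-hasEqTreeColoring : ∀ n t → 3 ≤ n → n % 4 ≢ 1 → 3 * n < 4 * t → HasEqTreeColoring (K3 n) t 3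
K3-hasEqTreeColoring n zero _ _ 3n<0 = ⊥-elim (n≮0 3n<0)
K3-hasEqTreeColoring n (suc t) 3≤n n%4≢1 3n<4t = colour , treeColouring , equitable
  where open K3-BlockColouring n (suc t) 3≤n n%4≢1 3n<4t

3n<4*3⌊[n+1]/4⌋ : ∀ n → n % 4 ≡ 3 → 3 * n < 4 * (3 * ((n + 1) / 4))
3n<4*3⌊[n+1]/4⌋ n n%4≡3 = subst (λ m → 3 * m < 4 * (3 * ((m + 1) / 4))) (sym n≡3+4q) (for-3+4q (n / 4))
  where
  n≡3+4q : n ≡ 3 + n / 4 * 4
  n≡3+4q = trans (m≡m%n+[m/n]*n n 4) (cong (_+ n / 4 * 4) n%4≡3)
  3+4q+1≡4[1+q] : ∀ q → 3 + q * 4 + 1 ≡ suc q * 4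
  3+4q+1≡4[1+q] = solve-∀
  4*3[1+q]≡3+3[3+4q] : ∀ q → 4 * (3 * suc q) ≡ 3 + 3 * (3 + q * 4)
  4*3[1+q]≡3+3[3+4q] = solve-∀
  for-3+4q : ∀ q → 3 * (3 + q * 4) < 4 * (3 * ((3 + q * 4 + 1) / 4))
  for-3+4q q = subst (3 * (3 + q * 4) <_) (sym (begin
    4 * (3 * ((3 + q * 4 + 1) / 4))   ≡⟨ cong (λ m → 4 * (3 * (m / 4))) (3+4q+1≡4[1+q] q) ⟩
    4 * (3 * (suc q * 4 / 4))         ≡⟨ cong (λ m → 4 * (3 * m)) (m*n/n≡m (suc q) 4) ⟩
    4 * (3 * suc q)                   ≡⟨ 4*3[1+q]≡3+3[3+4q] q ⟩
    3 + 3 * (3 + q * 4)               ∎)) (s≤s (m≤n+m _ 2))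
    where open ≡-Reasoning

theorem1 : (n : ℕ) → 0 < n → n % 4 ≡ 3 →
    StrongEqVA≤ (K3 n) 3 (3 * ((n + 1) / 4))
theorem1 n _ n%4≡3 = 3 * ((n + 1) / 4) , ≤-refl , λ t T≤t →
  K3-hasEqTreeColoring n t 3≤n n%4≢1 (<-≤-trans (3n<4*3⌊[n+1]/4⌋ n n%4≡3) (*-monoʳ-≤ 4 T≤t))
  where
  3≤n : 3 ≤ n
  3≤n = subst (_≤ n) n%4≡3 (m%n≤m n 4)
  n%4≢1 : n % 4 ≢ 1
  n%4≢1 n%4≡1 with () ← trans (sym n%4≡3) n%4≡1
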